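{- The incidence-forming functor $\mathcal{I}:\mathfrak{H}\to\mathfrak{R}$ is neither continuous nor cocontinuous.
   Context: A set-system hypergraph $G$ consists of sets $V(G)$, $E(G)$ and $\epsilon_G:E(G)\to\mathcal{P}(V(G))$; morphisms are pairs $(E(\phi),V(\phi))$ with $\epsilon_H\circ E(\phi)=\mathcal{P}V(\phi)\circ\epsilon_G$ ($\mathcal{P}f(A)$ the image); category $\mathfrak{H}$. An incidence hypergraph $G$ consists of sets $\check V(G)$ (vertices), $\check E(G)$ (edges), $I(G)$ (incidences) and functions $\varsigma_G:I(G)\to\check V(G)$, $\omega_G:I(G)\to\check E(G)$; a morphism $\phi:G\to H$ is a triple of functions $\check V(\phi),\check E(\phi),I(\phi)$ with $\varsigma_H\circ I(\phi)=\check V(\phi)\circ\varsigma_G$ and $\omega_H\circ I(\phi)=\check E(\phi)\circ\omega_G$; this is the category $\mathfrak{R}$. The functor $\mathcal{I}$ sends $G$ to the incidence hypergraph with vertices $V(G)$, edges $E(G)$, incidences $\{(v,e)\in V(G)\times E(G):v\in\epsilon_G(e)\}$, $\varsigma(v,e)=v$, $\omega(v,e)=e$, and sends $\phi$ to $(V(\phi),E(\phi),(v,e)\mapsto(V(\phi)(v),E(\phi)(e)))$. -}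

module Defs where

open import Level using (Level; _⊔_; 0ℓ) renaming (suc to lsuc)
open import Data.Product using (Σ; ∃; _×_; _,_; proj₁; proj₂)
open import Relation.Binary.PropositionalEquality
  using (_≡_; refl; sym; trans; cong)
open import Relation.Nullary using (¬_)

record Category (o h e : Level) : Set (lsuc (o ⊔ h ⊔ e)) where
  infixr 9 _∘_
  infix  4 _≈_
  field
    Obj    : Set o
    _⇒_    : Obj → Obj → Set h
    _≈_    : ∀ {A B} → A ⇒ B → A ⇒ B → Set e
    id     : ∀ {A} → A ⇒ A
    _∘_    : ∀ {A B C} → B ⇒ C → A ⇒ B → A ⇒ C
    ≈-refl  : ∀ {A B} {f : A ⇒ B} → f ≈ f
    ≈-sym   : ∀ {A B} {f g : A ⇒ B} → f ≈ g → g ≈ f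
    ≈-trans : ∀ {A B} {f g k : A ⇒ B} → f ≈ g → g ≈ k → f ≈ k
    ∘-resp-≈ : ∀ {A B C} {f f' : B ⇒ C} {g g' : A ⇒ B} →
               f ≈ f' → g ≈ g' → f ∘ g ≈ f' ∘ g'
    identityˡ : ∀ {A B} {f : A ⇒ B} → id ∘ f ≈ f
    identityʳ : ∀ {A B} {f : A ⇒ B} → f ∘ id ≈ f
    assoc     : ∀ {A B C D} {f : A ⇒ B} {g : B ⇒ C} {k : C ⇒ D} →
                (k ∘ g) ∘ f ≈ k ∘ (g ∘ f)

record Functor {o h e o' h' e' : Level}
               (C : Category o h e) (D : Category o' h' e')
               : Set (o ⊔ h ⊔ e ⊔ o' ⊔ h' ⊔ e') where
  private
    module C = Category C
    module D = Category D
  field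
    F₀ : C.Obj → D.Obj
    F₁ : ∀ {A B} → A C.⇒ B → F₀ A D.⇒ F₀ B
    F-resp-≈ : ∀ {A B} {f g : A C.⇒ B} → f C.≈ g → F₁ f D.≈ F₁ g
    F-identity : ∀ {A} → F₁ (C.id {A}) D.≈ D.id
    F-homomorphism : ∀ {A B C'} {f : A C.⇒ B} {g : B C.⇒ C'} →
                     F₁ (g C.∘ f) D.≈ F₁ g D.∘ F₁ f

open Functor

_∘F_ : ∀ {o h e o' h' e' o'' h'' e''}
       {B : Category o h e} {C : Category o' h' e'} {D : Category o'' h'' e''} →
       Functor C D → Functor B C → Functor B D
_∘F_ {C = C} {D = D} G F = record
  { F₀ = λ X → F₀ G (F₀ F X)
  ; F₁ = λ f → F₁ G (F₁ F f)
  ; F-resp-≈ = λ p → F-resp-≈ G (F-resp-≈ F p)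
  ; F-identity = D.≈-trans (F-resp-≈ G (F-identity F)) (F-identity G)
  ; F-homomorphism = D.≈-trans (F-resp-≈ G (F-homomorphism F)) (F-homomorphism G)
  }
  where module D = Category D

module _ {o h e : Level} {C : Category o h e} where
  open Category C

  record Cone {J : Category 0ℓ 0ℓ 0ℓ} (Dg : Functor J C) : Set (o ⊔ h ⊔ e) where
    field
      apex : Obj
      π    : ∀ j → apex ⇒ F₀ Dg j
      comm : ∀ {i j} (f : Category._⇒_ J i j) → F₁ Dg f ∘ π i ≈ π j

  record Cocone {J : Category 0ℓ 0ℓ 0ℓ} (Dg : Functor J C) : Set (o ⊔ h ⊔ e) where
    field
      coapex : Obj
      ι      : ∀ j → F₀ Dg j ⇒ coapex
      comm   : ∀ {i j} (f : Category._⇒_ J i j) → ι j ∘ F₁ Dg f ≈ ι i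

  IsLimit : {J : Category 0ℓ 0ℓ 0ℓ} {Dg : Functor J C} → Cone Dg → Set (o ⊔ h ⊔ e)
  IsLimit {J} {Dg} L =
    (K : Cone Dg) →
    Σ (Cone.apex K ⇒ Cone.apex L) λ u →
      (∀ j → Cone.π L j ∘ u ≈ Cone.π K j) ×
      (∀ (u' : Cone.apex K ⇒ Cone.apex L) →
         (∀ j → Cone.π L j ∘ u' ≈ Cone.π K j) → u' ≈ u)

  IsColimit : {J : Category 0ℓ 0ℓ 0ℓ} {Dg : Functor J C} → Cocone Dg → Set (o ⊔ h ⊔ e)
  IsColimit {J} {Dg} L =
    (K : Cocone Dg) →
    Σ (Cocone.coapex L ⇒ Cocone.coapex K) λ u →
      (∀ j → u ∘ Cocone.ι L j ≈ Cocone.ι K j) ×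
      (∀ (u' : Cocone.coapex L ⇒ Cocone.coapex K) →
         (∀ j → u' ∘ Cocone.ι L j ≈ Cocone.ι K j) → u' ≈ u)

module _ {o h e o' h' e' : Level} {C : Category o h e} {D : Category o' h' e'}
         (F : Functor C D) where
  private
    module C = Category C
    module D = Category D

  mapCone : {J : Category 0ℓ 0ℓ 0ℓ} {Dg : Functor J C} → Cone Dg → Cone (F ∘F Dg)
  mapCone {Dg = Dg} K = record
    { apex = F₀ F (Cone.apex K)
    ; π    = λ j → F₁ F (Cone.π K j)
    ; comm = λ f → D.≈-trans (D.≈-sym (F-homomorphism F)) (F-resp-≈ F (Cone.comm K f))
    }

  mapCocone : {J : Category 0ℓ 0ℓ 0ℓ} {Dg : Functor J C} → Cocone Dg → Cocone (F ∘F Dg)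
  mapCocone {Dg = Dg} K = record
    { coapex = F₀ F (Cocone.coapex K)
    ; ι      = λ j → F₁ F (Cocone.ι K j)
    ; comm   = λ f → D.≈-trans (D.≈-sym (F-homomorphism F)) (F-resp-≈ F (Cocone.comm K f))
    }

  Continuous : Set (lsuc 0ℓ ⊔ o ⊔ h ⊔ e ⊔ o' ⊔ h' ⊔ e')
  Continuous = (J : Category 0ℓ 0ℓ 0ℓ) (Dg : Functor J C) (L : Cone Dg) →
               IsLimit L → IsLimit (mapCone L)

  Cocontinuous : Set (lsuc 0ℓ ⊔ o ⊔ h ⊔ e ⊔ o' ⊔ h' ⊔ e')
  Cocontinuous = (J : Category 0ℓ 0ℓ 0ℓ) (Dg : Functor J C) (L : Cocone Dg) →
                 IsColimit L → IsColimit (mapCocone L)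

-- Set-system hypergraphs: subsets of V are proof-irrelevant predicates

record SetSysHyp : Set₁ where
  field
    V : Set
    E : Set
    ε : E → V → Set
    ε-prop : ∀ e v (p q : ε e v) → p ≡ q

open SetSysHyp

Img : {A B : Set} → (A → B) → (A → Set) → B → Set
Img f S w = ∃ λ v → S v × f v ≡ w

record SetSysHom (G H : SetSysHyp) : Set where
  field
    Vm : V G → V H
    Em : E G → E H
    -- ε_H ∘ E(φ) = 𝒫V(φ) ∘ ε_G  (equality of subsets, extensionally)
    comm→ : ∀ e w → ε H (Em e) w → Img Vm (ε G e) w
    comm← : ∀ e w → Img Vm (ε G e) w → ε H (Em e) w

open SetSysHom

𝔥 : Category (lsuc 0ℓ) 0ℓ 0ℓ
𝔥 = record
  { Obj = SetSysHyp
  ; _⇒_ = SetSysHom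
  ; _≈_ = λ φ ψ → (∀ v → Vm φ v ≡ Vm ψ v) × (∀ e → Em φ e ≡ Em ψ e)
  ; id = record { Vm = λ v → v ; Em = λ e → e
                ; comm→ = λ e w p → w , p , refl
                ; comm← = λ { e w (v , p , refl) → p } }
  ; _∘_ = comp
  ; ≈-refl = (λ _ → refl) , (λ _ → refl)
  ; ≈-sym = λ (p , q) → (λ v → sym (p v)) , (λ e → sym (q e))
  ; ≈-trans = λ (p , q) (p' , q') → (λ v → trans (p v) (p' v)) , (λ e → trans (q e) (q' e))
  ; ∘-resp-≈ = λ {_} {_} {_} {f} {f'} {g} {g'} (p , q) (p' , q') →
      (λ v → trans (cong (Vm f) (p' v)) (p (Vm g' v))) ,
      (λ e → trans (cong (Em f) (q' e)) (q (Em g' e)))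
  ; identityˡ = (λ _ → refl) , (λ _ → refl)
  ; identityʳ = (λ _ → refl) , (λ _ → refl)
  ; assoc = (λ _ → refl) , (λ _ → refl)
  }
  where
  comp : ∀ {A B C} → SetSysHom B C → SetSysHom A B → SetSysHom A C
  comp {A} {B} {C} g f = record
    { Vm = λ v → Vm g (Vm f v)
    ; Em = λ e → Em g (Em f e)
    ; comm→ = λ e w p →
        let (u , pu , eu) = comm→ g (Em f e) w p
            (v , pv , ev) = comm→ f e u pu
        in v , pv , trans (cong (Vm g) ev) eu
    ; comm← = λ { e w (v , pv , refl) →
        comm← g (Em f e) w (Vm f v , comm← f e (Vm f v) (v , pv , refl) , refl) }
    }

record IncHyp : Set₁ where
  field
    Vˇ : Set
    Eˇ : Set
    I  : Set
    ς  : I → Vˇ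
    ω  : I → Eˇ

open IncHyp

record IncHom (G H : IncHyp) : Set where
  field
    Vφ : Vˇ G → Vˇ H
    Eφ : Eˇ G → Eˇ H
    Iφ : I G → I H
    ς-comm : ∀ i → ς H (Iφ i) ≡ Vφ (ς G i)
    ω-comm : ∀ i → ω H (Iφ i) ≡ Eφ (ω G i)

open IncHom

𝔯 : Category (lsuc 0ℓ) 0ℓ 0ℓ
𝔯 = record
  { Obj = IncHyp
  ; _⇒_ = IncHom
  ; _≈_ = λ φ ψ → (∀ v → Vφ φ v ≡ Vφ ψ v) × (∀ e → Eφ φ e ≡ Eφ ψ e)
                  × (∀ i → Iφ φ i ≡ Iφ ψ i)
  ; id = record { Vφ = λ v → v ; Eφ = λ e → e ; Iφ = λ i → i
                ; ς-comm = λ _ → refl ; ω-comm = λ _ → refl }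
  ; _∘_ = λ g f → record
      { Vφ = λ v → Vφ g (Vφ f v) ; Eφ = λ e → Eφ g (Eφ f e) ; Iφ = λ i → Iφ g (Iφ f i)
      ; ς-comm = λ i → trans (ς-comm g (Iφ f i)) (cong (Vφ g) (ς-comm f i))
      ; ω-comm = λ i → trans (ω-comm g (Iφ f i)) (cong (Eφ g) (ω-comm f i)) }
  ; ≈-refl = (λ _ → refl) , (λ _ → refl) , (λ _ → refl)
  ; ≈-sym = λ (p , q , r) → (λ v → sym (p v)) , (λ e → sym (q e)) , (λ i → sym (r i))
  ; ≈-trans = λ (p , q , r) (p' , q' , r') →
      (λ v → trans (p v) (p' v)) , (λ e → trans (q e) (q' e)) , (λ i → trans (r i) (r' i))
  ; ∘-resp-≈ = λ {_} {_} {_} {f} {f'} {g} {g'} (p , q , r) (p' , q' , r') →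
      (λ v → trans (cong (Vφ f) (p' v)) (p (Vφ g' v))) ,
      (λ e → trans (cong (Eφ f) (q' e)) (q (Eφ g' e))) ,
      (λ i → trans (cong (Iφ f) (r' i)) (r (Iφ g' i)))
  ; identityˡ = (λ _ → refl) , (λ _ → refl) , (λ _ → refl)
  ; identityʳ = (λ _ → refl) , (λ _ → refl) , (λ _ → refl)
  ; assoc = (λ _ → refl) , (λ _ → refl) , (λ _ → refl)
  }

Incidences : SetSysHyp → Set
Incidences G = Σ (V G) λ v → Σ (E G) λ e → ε G e v

inc-≡ : (G : SetSysHyp) {v v' : V G} {e e' : E G} → v ≡ v' → e ≡ e' →
        (p : ε G e v) (p' : ε G e' v') →
        _≡_ {A = Incidences G} (v , e , p) (v' , e' , p')
inc-≡ G refl refl p p' = cong (λ q → _ , _ , q) (ε-prop G _ _ p p')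

𝓘₀ : SetSysHyp → IncHyp
𝓘₀ G = record
  { Vˇ = V G ; Eˇ = E G ; I = Incidences G
  ; ς = proj₁ ; ω = λ i → proj₁ (proj₂ i) }

𝓘₁ : ∀ {G H} → SetSysHom G H → IncHom (𝓘₀ G) (𝓘₀ H)
𝓘₁ φ = record
  { Vφ = Vm φ ; Eφ = Em φ
  ; Iφ = λ (v , e , p) → Vm φ v , Em φ e , comm← φ e (Vm φ v) (v , p , refl)
  ; ς-comm = λ _ → refl ; ω-comm = λ _ → refl }

𝓘 : Functor 𝔥 𝔯
𝓘 = record
  { F₀ = 𝓘₀
  ; F₁ = 𝓘₁
  ; F-resp-≈ = λ {A} {B} (p , q) →
      p , q , (λ (v , e , x) → inc-≡ B (p v) (q e) _ _)
  ; F-identity = λ {A} → (λ _ → refl) , (λ _ → refl) , (λ (v , e , x) → inc-≡ A refl refl _ _)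
  ; F-homomorphism = λ {A} {B} {C} →
      (λ _ → refl) , (λ _ → refl) , (λ (v , e , x) → inc-≡ C refl refl _ _)
  }

module Submission where

-- 𝓘 is neither continuous nor cocontinuous; both failures are witnessed by
-- diagrams of parallel-pair shape.
--
-- In 𝔥 the equalizer of two maps whose vertex maps disagree
-- everywhere, out of a hypergraph all of whose edges are non-empty, is the
-- empty hypergraph: a vertex of a cone would be equalized, and an edge of a
-- cone would contain such a vertex.  In 𝔯 the edge of an incidence hypergraph
-- needs no incidences, so the lone edge of Y = ({0,1}, {{0,1}}), fixed by the
-- vertex swap, forms a cone over 𝓘 of the pair (id, swap) which admits no
-- map into 𝓘 of the (empty) equalizer.
--
-- Identifying the two vertices of Y gives the coequalizer in 𝔥 of
-- the two inclusions of a point; it has a single incidence.  In 𝔯 nothing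
-- identifies the two incidences of 𝓘 Y, so the cocone sending them to two
-- distinct incidences cannot factor through 𝓘 of that coequalizer.

open import Defs
open import Level using (Level; 0ℓ)
open import Data.Product using (_×_; _,_; proj₁; proj₂; ∃)
open import Data.Unit using (⊤; tt)
open import Data.Empty using (⊥; ⊥-elim)
open import Data.Bool using (Bool; true; false; not)
open import Data.Bool.Properties using (not-involutive; not-¬)
open import Relation.Nullary using (¬_)
open import Relation.Binary.PropositionalEquality
  using (_≡_; refl; sym; trans)

open SetSysHyp
open SetSysHom
open IncHyp
open IncHom
open Functor

data Shape : Set where
  src tgt : Shape

data Arrow : Shape → Shape → Set where
  idA : ∀ {x} → Arrow x x
  par : Bool → Arrow src tgt

compose : ∀ {x y z} → Arrow y z → Arrow x y → Arrow x z
compose idA     f   = f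
compose (par b) idA = par b

compose-idʳ : ∀ {x y} (f : Arrow x y) → compose f idA ≡ f
compose-idʳ idA     = refl
compose-idʳ (par b) = refl

compose-assoc : ∀ {w x y z} (f : Arrow w x) (g : Arrow x y) (k : Arrow y z) →
                compose (compose k g) f ≡ compose k (compose g f)
compose-assoc f       g   idA     = refl
compose-assoc idA     idA (par b) = refl

ParallelPair : Category 0ℓ 0ℓ 0ℓ
ParallelPair = record
  { Obj = Shape ; _⇒_ = Arrow ; _≈_ = _≡_ ; id = idA ; _∘_ = compose
  ; ≈-refl = refl ; ≈-sym = sym ; ≈-trans = trans
  ; ∘-resp-≈ = λ { refl refl → refl }
  ; identityˡ = refl
  ; identityʳ = λ {_} {_} {f} → compose-idʳ f
  ; assoc = λ {_} {_} {_} {_} {f} {g} {k} → compose-assoc f g k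
  }

module _ {o h e : Level} {C : Category o h e} where
  open Category C

  parallel : ∀ {A B} → A ⇒ B → A ⇒ B → Functor ParallelPair C
  parallel {A} {B} f g = record
    { F₀ = obj ; F₁ = arr
    ; F-resp-≈ = λ { refl → ≈-refl }
    ; F-identity = ≈-refl
    ; F-homomorphism = λ {_} {_} {_} {a} {b} → homomorphism a b
    }
    where
    obj : Shape → Obj
    obj src = A
    obj tgt = B
    arr : ∀ {x y} → Arrow x y → obj x ⇒ obj y
    arr idA         = id
    arr (par false) = f
    arr (par true)  = g
    homomorphism : ∀ {x y z} (a : Arrow x y) (b : Arrow y z) →
                   arr (compose b a) ≈ arr b ∘ arr a
    homomorphism a       idA     = ≈-sym identityˡ
    homomorphism idA     (par b) = ≈-sym identityʳ

  module _ (D : Functor ParallelPair C) where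
    private
      left right : F₀ D src ⇒ F₀ D tgt
      left  = F₁ D (par false)
      right = F₁ D (par true)

    fork : ∀ {X} (k : X ⇒ F₀ D src) → left ∘ k ≈ right ∘ k → Cone D
    fork {X} k equalizes = record { apex = X ; π = π ; comm = comm }
      where
      π : ∀ x → X ⇒ F₀ D x
      π src = k
      π tgt = left ∘ k
      comm : ∀ {x y} (a : Arrow x y) → F₁ D a ∘ π x ≈ π y
      comm idA         = ≈-trans (∘-resp-≈ (F-identity D) ≈-refl) identityˡ
      comm (par false) = ≈-refl
      comm (par true)  = ≈-sym equalizes

    cofork : ∀ {X} (q : F₀ D tgt ⇒ X) → q ∘ left ≈ q ∘ right → Cocone D
    cofork {X} q coequalizes = record { coapex = X ; ι = ι ; comm = comm }
      where
      ι : ∀ x → F₀ D x ⇒ X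
      ι src = q ∘ left
      ι tgt = q
      comm : ∀ {x y} (a : Arrow x y) → ι y ∘ F₁ D a ≈ ι x
      comm idA         = ≈-trans (∘-resp-≈ ≈-refl (F-identity D)) identityʳ
      comm (par false) = ≈-refl
      comm (par true)  = ≈-sym coequalizes

module _ {o h e o' h' e' : Level} {C : Category o h e} {D : Category o' h' e'}
         (F : Functor C D) where
  open Category D

  not-continuous : ∀ {J} {Dg : Functor J C} {L : Cone Dg} → IsLimit L →
                   (K : Cone (F ∘F Dg)) → ¬ (Cone.apex K ⇒ F₀ F (Cone.apex L)) →
                   ¬ Continuous F
  not-continuous {J} {Dg} {L} isLimit K noMap continuous =
    noMap (proj₁ (continuous J Dg L isLimit K))

  not-cocontinuous : ∀ {J} {Dg : Functor J C} {L : Cocone Dg} → IsColimit L →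
                     (K : Cocone (F ∘F Dg)) →
                     (∀ u → ¬ (∀ j → u ∘ F₁ F (Cocone.ι L j) ≈ Cocone.ι K j)) →
                     ¬ Cocontinuous F
  not-cocontinuous {J} {Dg} {L} isColimit K noFactor cocontinuous =
    let (u , factors , _) = cocontinuous J Dg L isColimit K in noFactor u factors

module 𝔥 = Category 𝔥
module 𝔯 = Category 𝔯

Y : SetSysHyp
Y = record { V = Bool ; E = ⊤ ; ε = λ _ _ → ⊤ ; ε-prop = λ _ _ _ _ → refl }

Empty : SetSysHyp
Empty = record { V = ⊥ ; E = ⊥ ; ε = λ () ; ε-prop = λ () }

fromEmpty : ∀ {G} → SetSysHom Empty G
fromEmpty = record { Vm = λ () ; Em = λ () ; comm→ = λ () ; comm← = λ () }

toEmpty : ∀ {G} → ¬ V G → ¬ E G → SetSysHom G Empty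
toEmpty noV noE = record
  { Vm = λ v → noV v ; Em = λ e → noE e
  ; comm→ = λ e → ⊥-elim (noE e) ; comm← = λ e → ⊥-elim (noE e) }

module Equalizer {A B : SetSysHyp} (f g : SetSysHom A B)
                 (disagree : ∀ v → ¬ Vm f v ≡ Vm g v)
                 (nonEmpty : ∀ e → ∃ (ε A e)) where

  diagram : Functor ParallelPair 𝔥
  diagram = parallel f g

  equalizer : Cone diagram
  equalizer = fork diagram fromEmpty ((λ ()) , (λ ()))

  isEqualizer : IsLimit equalizer
  isEqualizer K = toEmpty noV noE , (λ _ → vacuous) , (λ _ _ → vacuous)
    where
    πs = Cone.π K src
    -- a vertex of the cone would be sent to a vertex equalized by f and g
    noV : ¬ V (Cone.apex K)
    noV x = disagree (Vm πs x)
      (trans (proj₁ (Cone.comm K (par false)) x) (sym (proj₁ (Cone.comm K (par true)) x)))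
    -- an edge of the cone has non-empty image, hence contains a vertex
    noE : ¬ E (Cone.apex K)
    noE e = let (v , v∈e) = nonEmpty (Em πs e) in noV (proj₁ (comm→ πs e v v∈e))
    vacuous : ∀ {P : V (Cone.apex K) → Set} {Q : E (Cone.apex K) → Set} →
              (∀ v → P v) × (∀ e → Q e)
    vacuous = (λ v → ⊥-elim (noV v)) , (λ e → ⊥-elim (noE e))

swap : SetSysHom Y Y
swap = record
  { Vm = not ; Em = λ e → e
  ; comm→ = λ _ w _ → not w , tt , not-involutive w
  ; comm← = λ _ _ _ → tt }

open Equalizer 𝔥.id swap (λ _ → not-¬ refl) (λ _ → true , tt)

-- 𝓘 loses the equalizer: the lone edge fixed by 𝓘 swap has nowhere to go.
loneEdge : IncHyp
loneEdge = record { Vˇ = ⊥ ; Eˇ = ⊤ ; I = ⊥ ; ς = λ () ; ω = λ () }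

notContinuous : ¬ Continuous 𝓘
notContinuous = not-continuous 𝓘 {L = equalizer} isEqualizer edgeCone (λ φ → Eφ φ tt)
  where
  edgeOfY : IncHom loneEdge (𝓘₀ Y)
  edgeOfY = record { Vφ = λ () ; Eφ = λ _ → tt ; Iφ = λ ()
                   ; ς-comm = λ () ; ω-comm = λ () }
  edgeCone : Cone (𝓘 ∘F diagram)
  edgeCone = fork (𝓘 ∘F diagram) edgeOfY ((λ ()) , (λ _ → refl) , (λ ()))

Point : SetSysHyp
Point = record { V = ⊤ ; E = ⊥ ; ε = λ () ; ε-prop = λ () }

vertex : Bool → SetSysHom Point Y
vertex b = record { Vm = λ _ → b ; Em = λ () ; comm→ = λ () ; comm← = λ () }

Loop : SetSysHyp
Loop = record { V = ⊤ ; E = ⊤ ; ε = λ _ _ → ⊤ ; ε-prop = λ _ _ _ _ → refl }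

collapse : SetSysHom Y Loop
collapse = record
  { Vm = λ _ → tt ; Em = λ _ → tt
  ; comm→ = λ _ _ _ → true , tt , refl ; comm← = λ _ _ _ → tt }

vertexPair : Functor ParallelPair 𝔥
vertexPair = parallel (vertex false) (vertex true)

coequalizer : Cocone vertexPair
coequalizer = cofork vertexPair collapse ((λ _ → refl) , (λ ()))

isCoequalizer : IsColimit coequalizer
isCoequalizer K = u , factors , unique
  where
  ιt = Cocone.ι K tgt
  glued : ∀ b → Vm ιt false ≡ Vm ιt b
  glued false = refl
  glued true  = trans (proj₁ (Cocone.comm K (par false)) tt)
                      (sym (proj₁ (Cocone.comm K (par true)) tt))
  u : SetSysHom Loop (Cocone.coapex K)
  u = record
    { Vm = λ _ → Vm ιt false ; Em = λ _ → Em ιt tt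
    ; comm→ = λ _ w w∈e → let (b , _ , eq) = comm→ ιt tt w w∈e
                           in tt , tt , trans (glued b) eq
    ; comm← = λ { _ w (_ , _ , eq) → comm← ιt tt w (false , tt , eq) } }
  factors : ∀ x → (u 𝔥.∘ Cocone.ι coequalizer x) 𝔥.≈ Cocone.ι K x
  factors src = (λ _ → proj₁ (Cocone.comm K (par false)) tt) , (λ ())
  factors tgt = glued , (λ _ → refl)
  unique : ∀ u' → (∀ x → (u' 𝔥.∘ Cocone.ι coequalizer x) 𝔥.≈ Cocone.ι K x) → u' 𝔥.≈ u
  unique u' factors' = (λ _ → proj₁ (factors' tgt) false) , (λ _ → proj₂ (factors' tgt) tt)

-- 𝓘 loses the coequalizer: the two incidences of 𝓘 Y stay distinct in 𝔯.
twoIncidences : IncHyp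
twoIncidences = record { Vˇ = ⊤ ; Eˇ = ⊤ ; I = Bool ; ς = λ _ → tt ; ω = λ _ → tt }

notCocontinuous : ¬ Cocontinuous 𝓘
notCocontinuous = not-cocontinuous 𝓘 {L = coequalizer} isCoequalizer incidenceCocone noFactor
  where
  incidenceOfY : IncHom (𝓘₀ Y) twoIncidences
  incidenceOfY = record { Vφ = λ _ → tt ; Eφ = λ _ → tt ; Iφ = proj₁
                        ; ς-comm = λ _ → refl ; ω-comm = λ _ → refl }
  incidenceCocone : Cocone (𝓘 ∘F vertexPair)
  incidenceCocone = cofork (𝓘 ∘F vertexPair) incidenceOfY
    ((λ _ → refl) , (λ ()) , (λ { (_ , () , _) }))
  -- both incidences of 𝓘 Y go to the single incidence of 𝓘 Loop
  noFactor : ∀ u → ¬ (∀ x → (u 𝔯.∘ 𝓘₁ (Cocone.ι coequalizer x)) 𝔯.≈ Cocone.ι incidenceCocone x)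
  noFactor u factors = not-¬ refl (trans (sym (sendsTo false)) (sendsTo true))
    where
    sendsTo : ∀ b → Iφ u (tt , tt , tt) ≡ b
    sendsTo b = proj₂ (proj₂ (factors tgt)) (b , tt , tt)

mainTheorem13 : ¬ Continuous 𝓘 × ¬ Cocontinuous 𝓘
mainTheorem13 = notContinuous , notCocontinuous
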